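{- (1) Every reflexive integer relation $R\in\mathcal R_n$, $n\ge1$, is obtained from $\#$ by finitely many applications of the binary products $*_\alpha$ ($\alpha\in S_{\mathcal R}$); that is, $\bigoplus_{n\ge1}\mathbb K[\mathcal R_n]$ is generated by $\#$ as an $S_{\mathcal R}$-magmatic algebra. (2) For every $\alpha$, the product $*_\alpha$ satisfies the unital infinitesimal relation with $\Delta_{\mathcal R}$: for $P\in\mathcal R_n$, $Q\in\mathcal R_m$ ($n,m\ge1$), $\Delta_{\mathcal R}(P*_\alpha Q)=\sum P_{(1)}\otimes(P_{(2)}*_\alpha Q)+\sum(P*_\alpha Q_{(1)})\otimes Q_{(2)}-P\otimes Q$, with the empty relation acting as a two-sided unit for $*_\alpha$.
   Context: $\mathcal R_n$ is the set of reflexive relations on $[n]$; $\mathcal R_0$ consists of the empty relation; $\#$ is the unique element of $\mathcal R_1$. For $R\in\mathcal R_n$ and $S=\{s_1<\dots<s_k\}\subseteq[n]$, $R|_S\in\mathcal R_k$ is given by $(i,j)\in R|_S\iff(s_i,s_j)\in R$. $\Delta_{\mathcal R}(R)=\sum_{i=0}^nR|_{[i]}\otimes R|_{\{i+1,\dots,n\}}=\sum R_{(1)}\otimes R_{(2)}$. For $P\in\mathcal R_n$, $Q\in\mathcal R_m$, $P\sqcup Q$ is $P$ together with $Q$ shifted by $n$. $S_{\mathcal R}$ consists of $\sqcup$ (with $*_\sqcup=\sqcup$, size $0$) and all maps $\alpha:[r]\to\{\sqcup,\uparrow,\downarrow,\updownarrow\}$, $r\ge1$, with $\alpha(r)\ne\sqcup$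 (size $r$); $P*_\alpha Q$ is $P\sqcup Q$ together with, for $1\le i\le\min(r,m)$: $(n,n+i)$ if $\alpha(i)=\uparrow$; $(n+i,n)$ if $\alpha(i)=\downarrow$; both if $\alpha(i)=\updownarrow$. -}

module Defs where

open import Data.Nat using (ℕ; zero; suc; _+_; _∸_; _<?_; _≡ᵇ_)
import Data.Nat as ℕ
open import Data.Bool using (Bool; true; false; _∧_; _∨_)
import Data.Bool as 𝔹
open import Data.Fin using (Fin; toℕ; fromℕ; fromℕ<; splitAt)
open import Data.Sum using (inj₁; inj₂)
open import Data.Product using (Σ; _×_; _,_)
import Data.Product.Properties as ΣP
open import Data.Vec using (Vec; tabulate)
import Data.Vec.Properties as VP
open import Data.List using (List; []; _∷_; map; upTo; _++_)
open import Data.Integer using (ℤ; +_; -_) renaming (_+_ to _+ℤ_)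
open import Relation.Nullary using (yes; no)
open import Relation.Binary.PropositionalEquality using (_≡_; _≢_)
open import Relation.Binary.Definitions using (DecidableEquality)

-- Relations on [n] (encoded with 0-based indices Fin n; element k of Fin n
-- stands for k+1 ∈ [n]).  R i j = true  means  (i,j) ∈ R.

Rel : ℕ → Set
Rel n = Fin n → Fin n → Bool

Reflexive : ∀ {n} → Rel n → Set
Reflexive R = ∀ i → R i i ≡ true

RelΣ : Set
RelΣ = Σ ℕ Rel

∅ : Rel 0
∅ ()

♯ : Rel 1
♯ _ _ = true

-- Total lookup with 0-based natural-number indices (false out of range)
at : ∀ {n} → Rel n → ℕ → ℕ → Bool
at {n} R i j with i <? n | j <? n
... | yes p | yes q = R (fromℕ< p) (fromℕ< q)
... | _     | _     = false

restrictPre : ∀ {n} (i : ℕ) → Rel n → Rel i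
restrictPre i R a b = at R (toℕ a) (toℕ b)

restrictSuf : ∀ {n} (i : ℕ) → Rel n → Rel (n ∸ i)
restrictSuf i R a b = at R (i + toℕ a) (i + toℕ b)

-- Δ_R(R) = Σ_{i=0}^{n} R|[i] ⊗ R|{i+1..n}, as the list of its terms
Δterms : ∀ {n} → Rel n → List (RelΣ × RelΣ)
Δterms {n} R = map (λ i → (i , restrictPre i R) , (n ∸ i , restrictSuf i R)) (upTo (suc n))

data Arrow : Set where
  ⊔ ↑ ↓ ↕ : Arrow

-- sqcup   : the product ⊔ (size 0)
-- arr r α : the map α : [r+1] → {⊔,↑,↓,↕} (so size r+1 ≥ 1), with α(r+1) ≠ ⊔;
--           α k (k : Fin (suc r)) is the value at k+1.
data SR : Set where
  sqcup : SR
  arr   : (r : ℕ) (α : Fin (suc r) → Arrow) → α (fromℕ r) ≢ ⊔ → SR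

-- value of α at the 1-based position i; ⊔ when i ∉ [size α]
arrowAt : SR → ℕ → Arrow
arrowAt sqcup _ = ⊔
arrowAt (arr r α _) zero = ⊔
arrowAt (arr r α _) (suc k) with k <? suc r
... | yes p = α (fromℕ< p)
... | no _  = ⊔

isUp : Arrow → Bool
isUp ↑ = true
isUp ↕ = true
isUp _ = false

isDown : Arrow → Bool
isDown ↓ = true
isDown ↕ = true
isDown _ = false

isLast : ∀ {n} → Fin n → Bool
isLast {n} x = suc (toℕ x) ≡ᵇ n

-- P *_α Q : P ⊔ Q together with (n, n+i) if α(i) ∈ {↑,↕} and (n+i, n) if
-- α(i) ∈ {↓,↕}, for 1 ≤ i ≤ min(r, m).
prod : ∀ {n m} → SR → Rel n → Rel m → Rel (n + m)
prod {n} α P Q a b with splitAt n a | splitAt n b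
... | inj₁ x | inj₁ y = P x y
... | inj₂ x | inj₂ y = Q x y
... | inj₁ x | inj₂ y = isLast x ∧ isUp (arrowAt α (suc (toℕ y)))
... | inj₂ x | inj₁ y = isLast y ∧ isDown (arrowAt α (suc (toℕ x)))

_*[_]_ : RelΣ → SR → RelΣ → RelΣ
(n , P) *[ α ] (m , Q) = (n + m , prod α P Q)

data Term : Set where
  gen : Term
  node : Term → SR → Term → Term

eval : Term → RelΣ
eval gen = (1 , ♯)
eval (node s α t) = eval s *[ α ] eval t

-- Basis elements of ⊕_n K[R_n] (relations as concrete matrices, so that
-- equality is decidable) and formal ℤ-linear combinations of tensors.

Basis : Set
Basis = Σ ℕ (λ n → Vec (Vec Bool n) n)

toB : RelΣ → Basis
toB (n , R) = (n , tabulate (λ i → tabulate (λ j → R i j)))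

_≟B_ : DecidableEquality Basis
_≟B_ = ΣP.≡-dec ℕ._≟_ (VP.≡-dec (VP.≡-dec 𝔹._≟_))

Basis² : Set
Basis² = Basis × Basis

_≟B²_ : DecidableEquality Basis²
_≟B²_ = ΣP.≡-dec _≟B_ _≟B_

-- element of ⊕ K[R] ⊗ ⊕ K[R] as a finite list of (coefficient, basis tensor)
FormalSum : Set
FormalSum = List (ℤ × Basis²)

coeff : FormalSum → Basis² → ℤ
coeff [] t = + 0
coeff ((c , s) ∷ xs) t with s ≟B² t
... | yes _ = c +ℤ coeff xs t
... | no _  = coeff xs t

_≈F_ : FormalSum → FormalSum → Set
x ≈F y = ∀ t → coeff x t ≡ coeff y t

⊗ : ℤ → RelΣ → RelΣ → ℤ × Basis²
⊗ c A B = c , (toB A , toB B)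

Δ : RelΣ → FormalSum
Δ (n , R) = map (λ { (A , B) → ⊗ (+ 1) A B }) (Δterms R)

infinitesimalRHS : SR → RelΣ → RelΣ → FormalSum
infinitesimalRHS α (n , P) (m , Q) =
  map (λ { (A , B) → ⊗ (+ 1) A (B *[ α ] (m , Q)) }) (Δterms P)
  ++ map (λ { (A , B) → ⊗ (+ 1) ((n , P) *[ α ] A) B }) (Δterms Q)
  ++ (⊗ (- (+ 1)) (n , P) (m , Q) ∷ [])

{-# OPTIONS --safe #-}
-- (1) A reflexive R on [k+1] equals # *_α R|{2,…,k+1}, where α(j) records which of
-- (1, 1+j) and (1+j, 1) lie in R; induction on k then builds R from #.
-- (2) The only pairs of P *_α Q that join the two blocks have the last point n of P
-- as one end. So cutting P *_α Q after position i ≤ n gives P|[i] ⊗ (P|{i+1,…,n} *_α Q),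
-- and cutting after n + j gives (P *_α Q|[j]) ⊗ Q|{j+1,…,m}. The cut after n occurs in
-- both sums on the right (as i = n and as j = 0), and the term −P ⊗ Q cancels it.
module Submission where

open import Defs
open import Data.Nat using (ℕ; zero; suc; _+_; _∸_; _≤_; _<_; _<?_; _≡ᵇ_; z≤n; s≤s; z<s; s<s; s≤s⁻¹)
open import Data.Nat.Properties
  using (≤-refl; ≤-trans; <-≤-trans; <⇒≱; n≤1+n; m≤m+n; m<1+n⇒m<n∨m≡n; +-monoʳ-<; +-cancelˡ-<;
         +-assoc; +-suc; +-identityʳ; +-∸-comm; m+[n∸m]≡n; [m+n]∸[m+o]≡n∸o)
open import Data.Bool using (Bool; true; false; _∧_)
open import Data.Fin using (Fin; toℕ; fromℕ<; _↑ˡ_; _↑ʳ_)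
open import Data.Fin.Properties
  using (toℕ<n; toℕ-fromℕ<; fromℕ<-toℕ; toℕ-injective; toℕ-↑ˡ; toℕ-↑ʳ; splitAt-↑ˡ; splitAt-↑ʳ; toℕ-fromℕ)
open import Data.Product using (Σ; _×_; _,_; map₂)
open import Data.Sum using (inj₁; inj₂)
open import Data.Vec.Properties using (tabulate-cong)
open import Data.List using ([]; _∷_; _++_; map; upTo; applyUpTo)
open import Data.List.Properties using (map-∘; map-upTo; map-cong-local)
open import Data.List.Relation.Unary.All.Properties using (applyUpTo⁺₁)
open import Data.Integer using (ℤ; 1ℤ; -1ℤ; -_) renaming (_+_ to _+ℤ_)
import Data.Integer.Properties as ℤ
open import Algebra.Properties.AbelianGroup ℤ.+-0-abelianGroup using (xyx⁻¹≈y)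
open import Relation.Nullary using (Dec; yes; no; contradiction)
open import Relation.Binary.PropositionalEquality
  using (_≡_; refl; sym; trans; cong; cong₂; subst; module ≡-Reasoning)
open import Function using (_∘_; id)

open ≡-Reasoning

m<n∸o⇒o+m<n : ∀ {m n} o → m < n ∸ o → o + m < n
m<n∸o⇒o+m<n {n = n}     zero    m<n   = m<n
m<n∸o⇒o+m<n {n = suc n} (suc o) m<n∸o = s<s (m<n∸o⇒o+m<n o m<n∸o)

≡ᵇ-∸ : ∀ {i n} a → i ≤ n → (suc (i + a) ≡ᵇ n) ≡ (suc a ≡ᵇ n ∸ i)
≡ᵇ-∸ a z≤n       = refl
≡ᵇ-∸ a (s≤s i≤n) = ≡ᵇ-∸ a i≤n

fromℕ<-↑ˡ : ∀ {n} m {a} (a<n : a < n) → fromℕ< (<-≤-trans a<n (m≤m+n n m)) ≡ fromℕ< a<n ↑ˡ m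
fromℕ<-↑ˡ m {a} a<n = toℕ-injective (begin
  toℕ (fromℕ< _)           ≡⟨ toℕ-fromℕ< _ ⟩
  a                        ≡⟨ sym (toℕ-fromℕ< a<n) ⟩
  toℕ (fromℕ< a<n)         ≡⟨ sym (toℕ-↑ˡ _ m) ⟩
  toℕ (fromℕ< a<n ↑ˡ m)    ∎)

fromℕ<-↑ʳ : ∀ n {m a} (a<m : a < m) → fromℕ< (+-monoʳ-< n a<m) ≡ n ↑ʳ fromℕ< a<m
fromℕ<-↑ʳ n {a = a} a<m = toℕ-injective (begin
  toℕ (fromℕ< _)           ≡⟨ toℕ-fromℕ< _ ⟩
  n + a                    ≡⟨ cong (n +_) (sym (toℕ-fromℕ< a<m)) ⟩
  n + toℕ (fromℕ< a<m)     ≡⟨ sym (toℕ-↑ʳ n _) ⟩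
  toℕ (n ↑ʳ fromℕ< a<m)    ∎)

data Side (n : ℕ) : ℕ → Set where
  inside : ∀ {a} → a < n → Side n a
  beyond : ∀ a → Side n (n + a)

side : ∀ n a → Side n a
side zero    a       = beyond a
side (suc n) zero    = inside z<s
side (suc n) (suc a) with side n a
... | inside a<n = inside (s<s a<n)
... | beyond a   = beyond a

at-fromℕ< : ∀ {n} (R : Rel n) {a b} (a<n : a < n) (b<n : b < n) → at R a b ≡ R (fromℕ< a<n) (fromℕ< b<n)
at-fromℕ< {n} R {a} {b} a<n b<n with a <? n | b <? n
... | yes _   | yes _   = refl
... | no a≮n  | _       = contradiction a<n a≮n
... | yes _   | no b≮n  = contradiction b<n b≮n

at-toℕ : ∀ {n} (R : Rel n) (i j : Fin n) → at R (toℕ i) (toℕ j) ≡ R i j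
at-toℕ R i j = trans (at-fromℕ< R (toℕ<n i) (toℕ<n j)) (cong₂ R (fromℕ<-toℕ i _) (fromℕ<-toℕ j _))

at-refl : ∀ {n} (R : Rel n) → Reflexive R → ∀ {a} → a < n → at R a a ≡ true
at-refl R R-refl a<n = trans (at-fromℕ< R a<n a<n) (R-refl _)

at-restrictPre : ∀ {n} i (R : Rel n) {a b} → a < i → b < i → at (restrictPre i R) a b ≡ at R a b
at-restrictPre i R a<i b<i =
  trans (at-fromℕ< (restrictPre i R) a<i b<i) (cong₂ (at R) (toℕ-fromℕ< a<i) (toℕ-fromℕ< b<i))

at-restrictSuf : ∀ {n} i (R : Rel n) {a b} → a < n ∸ i → b < n ∸ i →
  at (restrictSuf i R) a b ≡ at R (i + a) (i + b)
at-restrictSuf i R a<k b<k =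
  trans (at-fromℕ< (restrictSuf i R) a<k b<k)
        (cong₂ (λ x y → at R (i + x) (i + y)) (toℕ-fromℕ< a<k) (toℕ-fromℕ< b<k))

restrictSuf-reflexive : ∀ {n} i {R : Rel n} → Reflexive R → Reflexive (restrictSuf i R)
restrictSuf-reflexive i {R} R-refl x = at-refl R R-refl (m<n∸o⇒o+m<n i (toℕ<n x))

-- Entrywise equality through the total lookup at; it lets relations whose size
-- indices are only propositionally equal be compared without transport.
infix 4 _≃_
_≃_ : RelΣ → RelΣ → Set
(k , R) ≃ (l , S) = k ≡ l × (∀ {a b} → a < k → b < k → at R a b ≡ at S a b)

toB-≃ : ∀ {A B} → A ≃ B → toB A ≡ toB B
toB-≃ {k , R} {_ , S} (refl , R≈S) = cong (k ,_) (tabulate-cong λ i → tabulate-cong λ j → begin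
  R i j                  ≡⟨ sym (at-toℕ R i j) ⟩
  at R (toℕ i) (toℕ j)   ≡⟨ R≈S (toℕ<n i) (toℕ<n j) ⟩
  at S (toℕ i) (toℕ j)   ≡⟨ at-toℕ S i j ⟩
  S i j                  ∎)

⊗-≃ : ∀ c {A A′ B B′} → A ≃ A′ → B ≃ B′ → ⊗ c A B ≡ ⊗ c A′ B′
⊗-≃ c A≃A′ B≃B′ = cong₂ (λ x y → c , x , y) (toB-≃ A≃A′) (toB-≃ B≃B′)

module _ (α : SR) {n m} (P : Rel n) (Q : Rel m) where

  private
    inl : ∀ {a} → a < n → a < n + m
    inl a<n = <-≤-trans a<n (m≤m+n n m)

    inr : ∀ {a} → a < m → n + a < n + m
    inr = +-monoʳ-< n

  at-prod-ll : ∀ {a b} (a<n : a < n) (b<n : b < n) → at (prod α P Q) a b ≡ at P a b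
  at-prod-ll a<n b<n
    rewrite at-fromℕ< (prod α P Q) (inl a<n) (inl b<n) | fromℕ<-↑ˡ m a<n | fromℕ<-↑ˡ m b<n
          | splitAt-↑ˡ n (fromℕ< a<n) m | splitAt-↑ˡ n (fromℕ< b<n) m
    = sym (at-fromℕ< P a<n b<n)

  at-prod-rr : ∀ {a b} (a<m : a < m) (b<m : b < m) → at (prod α P Q) (n + a) (n + b) ≡ at Q a b
  at-prod-rr a<m b<m
    rewrite at-fromℕ< (prod α P Q) (inr a<m) (inr b<m) | fromℕ<-↑ʳ n a<m | fromℕ<-↑ʳ n b<m
          | splitAt-↑ʳ n m (fromℕ< a<m) | splitAt-↑ʳ n m (fromℕ< b<m)
    = sym (at-fromℕ< Q a<m b<m)

  at-prod-lr : ∀ {a b} (a<n : a < n) (b<m : b < m) →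
    at (prod α P Q) a (n + b) ≡ (suc a ≡ᵇ n) ∧ isUp (arrowAt α (suc b))
  at-prod-lr a<n b<m
    rewrite at-fromℕ< (prod α P Q) (inl a<n) (inr b<m) | fromℕ<-↑ˡ m a<n | fromℕ<-↑ʳ n b<m
          | splitAt-↑ˡ n (fromℕ< a<n) m | splitAt-↑ʳ n m (fromℕ< b<m) | toℕ-fromℕ< a<n | toℕ-fromℕ< b<m
    = refl

  at-prod-rl : ∀ {a b} (a<m : a < m) (b<n : b < n) →
    at (prod α P Q) (n + a) b ≡ (suc b ≡ᵇ n) ∧ isDown (arrowAt α (suc a))
  at-prod-rl a<m b<n
    rewrite at-fromℕ< (prod α P Q) (inr a<m) (inl b<n) | fromℕ<-↑ʳ n a<m | fromℕ<-↑ˡ m b<n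
          | splitAt-↑ʳ n m (fromℕ< a<m) | splitAt-↑ˡ n (fromℕ< b<n) m | toℕ-fromℕ< a<m | toℕ-fromℕ< b<n
    = refl

prod-∅ˡ : ∀ α {n} (E : Rel 0) (P : Rel n) → (0 , E) *[ α ] (n , P) ≃ (n , P)
prod-∅ˡ α E P = refl , at-prod-rr α E P

prod-∅ʳ : ∀ α {n} (P : Rel n) (E : Rel 0) → (n , P) *[ α ] (0 , E) ≃ (n , P)
prod-∅ʳ α {n} P E = +-identityʳ n , λ a<n b<n → at-prod-ll α P E (shrink a<n) (shrink b<n)
  where
  shrink : ∀ {a} → a < n + 0 → a < n
  shrink = subst (_ <_) (+-identityʳ n)

module _ (α : SR) {n m} (P : Rel n) (Q : Rel m) where

  private
    PQ : Rel (n + m)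
    PQ = prod α P Q

    up down : ℕ → Bool
    up b = isUp (arrowAt α (suc b))
    down a = isDown (arrowAt α (suc a))

    beyond-shift : ∀ {i} → i ≤ n → ∀ a → i + (n ∸ i + a) ≡ n + a
    beyond-shift {i} i≤n a = trans (sym (+-assoc i (n ∸ i) a)) (cong (_+ a) (m+[n∸m]≡n i≤n))

    beyond<m : ∀ {i a} → i ≤ n → n ∸ i + a < n + m ∸ i → a < m
    beyond<m {i} {a} i≤n a<k = +-cancelˡ-< (n ∸ i) a m (subst (n ∸ i + a <_) (+-∸-comm m i≤n) a<k)

  restrictPre-prodˡ : ∀ {i} → i ≤ n → (i , restrictPre i PQ) ≃ (i , restrictPre i P)
  restrictPre-prodˡ {i} i≤n = refl , λ a<i b<i → begin
    at (restrictPre i PQ) _ _   ≡⟨ at-restrictPre i PQ a<i b<i ⟩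
    at PQ _ _                   ≡⟨ at-prod-ll α P Q (<-≤-trans a<i i≤n) (<-≤-trans b<i i≤n) ⟩
    at P _ _                    ≡⟨ sym (at-restrictPre i P a<i b<i) ⟩
    at (restrictPre i P) _ _    ∎

  at-prod-shift : ∀ {i a b} → i ≤ n → a < n + m ∸ i → b < n + m ∸ i →
    at PQ (i + a) (i + b) ≡ at (prod α (restrictSuf i P) Q) a b
  at-prod-shift {i} {a} {b} i≤n a<k b<k with side (n ∸ i) a | side (n ∸ i) b
  ... | inside a<k′ | inside b<k′ = begin
    at PQ (i + a) (i + b)    ≡⟨ at-prod-ll α P Q (m<n∸o⇒o+m<n i a<k′) (m<n∸o⇒o+m<n i b<k′) ⟩
    at P (i + a) (i + b)     ≡⟨ sym (at-restrictSuf i P a<k′ b<k′) ⟩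
    at (restrictSuf i P) a b ≡⟨ sym (at-prod-ll α (restrictSuf i P) Q a<k′ b<k′) ⟩
    at (prod α (restrictSuf i P) Q) a b ∎
  ... | beyond a | beyond b = begin
    at PQ (i + (n ∸ i + a)) (i + (n ∸ i + b))  ≡⟨ cong₂ (at PQ) (beyond-shift i≤n a) (beyond-shift i≤n b) ⟩
    at PQ (n + a) (n + b)                      ≡⟨ at-prod-rr α P Q (beyond<m i≤n a<k) (beyond<m i≤n b<k) ⟩
    at Q a b
      ≡⟨ sym (at-prod-rr α (restrictSuf i P) Q (beyond<m i≤n a<k) (beyond<m i≤n b<k)) ⟩
    at (prod α (restrictSuf i P) Q) (n ∸ i + a) (n ∸ i + b) ∎
  ... | inside a<k′ | beyond b = begin
    at PQ (i + a) (i + (n ∸ i + b))   ≡⟨ cong (at PQ (i + a)) (beyond-shift i≤n b) ⟩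
    at PQ (i + a) (n + b)             ≡⟨ at-prod-lr α P Q (m<n∸o⇒o+m<n i a<k′) (beyond<m i≤n b<k) ⟩
    (suc (i + a) ≡ᵇ n) ∧ up b         ≡⟨ cong (_∧ up b) (≡ᵇ-∸ a i≤n) ⟩
    (suc a ≡ᵇ n ∸ i) ∧ up b           ≡⟨ sym (at-prod-lr α (restrictSuf i P) Q a<k′ (beyond<m i≤n b<k)) ⟩
    at (prod α (restrictSuf i P) Q) a (n ∸ i + b) ∎
  ... | beyond a | inside b<k′ = begin
    at PQ (i + (n ∸ i + a)) (i + b)   ≡⟨ cong (λ x → at PQ x (i + b)) (beyond-shift i≤n a) ⟩
    at PQ (n + a) (i + b)             ≡⟨ at-prod-rl α P Q (beyond<m i≤n a<k) (m<n∸o⇒o+m<n i b<k′) ⟩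
    (suc (i + b) ≡ᵇ n) ∧ down a       ≡⟨ cong (_∧ down a) (≡ᵇ-∸ b i≤n) ⟩
    (suc b ≡ᵇ n ∸ i) ∧ down a         ≡⟨ sym (at-prod-rl α (restrictSuf i P) Q (beyond<m i≤n a<k) b<k′) ⟩
    at (prod α (restrictSuf i P) Q) (n ∸ i + a) b ∎

  restrictSuf-prodˡ : ∀ {i} → i ≤ n →
    (n + m ∸ i , restrictSuf i PQ) ≃ (n ∸ i , restrictSuf i P) *[ α ] (m , Q)
  restrictSuf-prodˡ {i} i≤n = +-∸-comm m i≤n , λ a<k b<k →
    trans (at-restrictSuf i PQ a<k b<k) (at-prod-shift i≤n a<k b<k)

  restrictPre-prodʳ : ∀ {j} → j ≤ m →
    (n + j , restrictPre (n + j) PQ) ≃ (n , P) *[ α ] (j , restrictPre j Q)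
  restrictPre-prodʳ {j} j≤m = refl , λ a<k b<k → trans (at-restrictPre (n + j) PQ a<k b<k) (cut a<k b<k)
    where
    Q′ : Rel j
    Q′ = restrictPre j Q

    inQ′ : ∀ {a} → n + a < n + j → a < j
    inQ′ {a} = +-cancelˡ-< n a j

    inQ : ∀ {a} → n + a < n + j → a < m
    inQ a<k = <-≤-trans (inQ′ a<k) j≤m

    cut : ∀ {a b} → a < n + j → b < n + j → at PQ a b ≡ at (prod α P Q′) a b
    cut {a} {b} a<k b<k with side n a | side n b
    ... | inside a<n | inside b<n =
      trans (at-prod-ll α P Q a<n b<n) (sym (at-prod-ll α P Q′ a<n b<n))
    ... | beyond a | beyond b = begin
      at PQ (n + a) (n + b)      ≡⟨ at-prod-rr α P Q (inQ a<k) (inQ b<k) ⟩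
      at Q a b                   ≡⟨ sym (at-restrictPre j Q (inQ′ a<k) (inQ′ b<k)) ⟩
      at Q′ a b                  ≡⟨ sym (at-prod-rr α P Q′ (inQ′ a<k) (inQ′ b<k)) ⟩
      at (prod α P Q′) (n + a) (n + b) ∎
    ... | inside a<n | beyond b =
      trans (at-prod-lr α P Q a<n (inQ b<k)) (sym (at-prod-lr α P Q′ a<n (inQ′ b<k)))
    ... | beyond a | inside b<n =
      trans (at-prod-rl α P Q (inQ a<k) b<n) (sym (at-prod-rl α P Q′ (inQ′ a<k) b<n))

  restrictSuf-prodʳ : ∀ j → (n + m ∸ (n + j) , restrictSuf (n + j) PQ) ≃ (m ∸ j , restrictSuf j Q)
  restrictSuf-prodʳ j = size , λ {a} {b} a<k b<k → begin
    at (restrictSuf (n + j) PQ) a b      ≡⟨ at-restrictSuf (n + j) PQ a<k b<k ⟩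
    at PQ (n + j + a) (n + j + b)        ≡⟨ cong₂ (at PQ) (+-assoc n j a) (+-assoc n j b) ⟩
    at PQ (n + (j + a)) (n + (j + b))    ≡⟨ at-prod-rr α P Q (inQ a<k) (inQ b<k) ⟩
    at Q (j + a) (j + b)                 ≡⟨ sym (at-restrictSuf j Q (shrink a<k) (shrink b<k)) ⟩
    at (restrictSuf j Q) a b             ∎
    where
    size : n + m ∸ (n + j) ≡ m ∸ j
    size = [m+n]∸[m+o]≡n∸o n m j

    shrink : ∀ {a} → a < n + m ∸ (n + j) → a < m ∸ j
    shrink {a} = subst (a <_) size

    inQ : ∀ {a} → a < n + m ∸ (n + j) → j + a < m
    inQ = m<n∸o⇒o+m<n j ∘ shrink

coeff-++ : ∀ xs ys t → coeff (xs ++ ys) t ≡ coeff xs t +ℤ coeff ys t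
coeff-++ []             ys t = sym (ℤ.+-identityˡ _)
coeff-++ ((c , s) ∷ xs) ys t with s ≟B² t
... | yes _ = trans (cong (c +ℤ_) (coeff-++ xs ys t)) (sym (ℤ.+-assoc c _ _))
... | no _  = coeff-++ xs ys t

coeff-neg : ∀ s t → coeff ((-1ℤ , s) ∷ []) t ≡ - coeff ((1ℤ , s) ∷ []) t
coeff-neg s t with s ≟B² t
... | yes _ = refl
... | no _  = refl

coeff-cancel : ∀ xs s ys t →
  coeff (xs ++ (1ℤ , s) ∷ ys ++ (-1ℤ , s) ∷ []) t ≡ coeff (xs ++ ys) t
coeff-cancel xs s ys t = begin
  coeff (xs ++ [+s] ++ ys ++ [-s]) t   ≡⟨ coeff-++ xs _ t ⟩
  X +ℤ coeff ([+s] ++ ys ++ [-s]) t    ≡⟨ cong (X +ℤ_) (coeff-++ [+s] _ t) ⟩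
  X +ℤ (c +ℤ coeff (ys ++ [-s]) t)     ≡⟨ cong (λ z → X +ℤ (c +ℤ z)) (coeff-++ ys [-s] t) ⟩
  X +ℤ (c +ℤ (Y +ℤ coeff [-s] t))      ≡⟨ cong (λ z → X +ℤ (c +ℤ (Y +ℤ z))) (coeff-neg s t) ⟩
  X +ℤ (c +ℤ (Y +ℤ - c))               ≡⟨ cong (X +ℤ_) (sym (ℤ.+-assoc c Y (- c))) ⟩
  X +ℤ (c +ℤ Y +ℤ - c)                 ≡⟨ cong (X +ℤ_) (xyx⁻¹≈y c Y) ⟩
  X +ℤ Y                               ≡⟨ sym (coeff-++ xs ys t) ⟩
  coeff (xs ++ ys) t                   ∎
  where
  [+s] [-s] : FormalSum
  [+s] = (1ℤ , s) ∷ []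
  [-s] = (-1ℤ , s) ∷ []
  X Y c : ℤ
  X = coeff xs t
  Y = coeff ys t
  c = coeff [+s] t

applyUpTo-+ : ∀ {A : Set} (f : ℕ → A) k l → applyUpTo f (k + l) ≡ applyUpTo f k ++ applyUpTo (f ∘ (k +_)) l
applyUpTo-+ f zero    l = refl
applyUpTo-+ f (suc k) l = cong (f 0 ∷_) (applyUpTo-+ (f ∘ suc) k l)

applyUpTo-cong : ∀ {A : Set} {f g : ℕ → A} k → (∀ {i} → i < k → f i ≡ g i) → applyUpTo f k ≡ applyUpTo g k
applyUpTo-cong {f = f} {g} k f≡g = begin
  applyUpTo f k     ≡⟨ map-upTo f k ⟨
  map f (upTo k)    ≡⟨ map-cong-local (applyUpTo⁺₁ id k f≡g) ⟩
  map g (upTo k)    ≡⟨ map-upTo g k ⟩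
  applyUpTo g k     ∎

map-Δterms : ∀ {A : Set} {n} (R : Rel n) (g : RelΣ × RelΣ → A) →
  map g (Δterms R) ≡ applyUpTo (λ i → g ((i , restrictPre i R) , (n ∸ i , restrictSuf i R))) (suc n)
map-Δterms {n = n} R g = trans (sym (map-∘ (upTo (suc n)))) (map-upTo _ (suc n))

module Infinitesimal (α : SR) {n m} (P : Rel n) (Q : Rel m) where

  private
    PQ : Rel (n + m)
    PQ = prod α P Q

  ΔPQ-term : ℕ → ℤ × Basis²
  ΔPQ-term i = ⊗ 1ℤ (i , restrictPre i PQ) (n + m ∸ i , restrictSuf i PQ)

  cutP-term : ℕ → ℤ × Basis²
  cutP-term i = ⊗ 1ℤ (i , restrictPre i P) ((n ∸ i , restrictSuf i P) *[ α ] (m , Q))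

  cutQ-term : ℕ → ℤ × Basis²
  cutQ-term j = ⊗ 1ℤ ((n , P) *[ α ] (j , restrictPre j Q)) (m ∸ j , restrictSuf j Q)

  ΔPQ-term-cutP : ∀ {i} → i ≤ n → ΔPQ-term i ≡ cutP-term i
  ΔPQ-term-cutP i≤n = ⊗-≃ 1ℤ (restrictPre-prodˡ α P Q i≤n) (restrictSuf-prodˡ α P Q i≤n)

  ΔPQ-term-cutQ : ∀ {j} → j ≤ m → ΔPQ-term (n + j) ≡ cutQ-term j
  ΔPQ-term-cutQ {j} j≤m = ⊗-≃ 1ℤ (restrictPre-prodʳ α P Q j≤m) (restrictSuf-prodʳ α P Q j)

  cutQ-term-zero : cutQ-term 0 ≡ ⊗ 1ℤ (n , P) (m , Q)
  cutQ-term-zero = ⊗-≃ 1ℤ (prod-∅ʳ α P (restrictPre 0 Q)) (refl , at-restrictSuf 0 Q)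

  cutP-terms cutQ-terms : FormalSum
  cutP-terms = applyUpTo cutP-term (suc n)
  cutQ-terms = applyUpTo (cutQ-term ∘ suc) m

  Δ-prod : Δ ((n , P) *[ α ] (m , Q)) ≡ cutP-terms ++ cutQ-terms
  Δ-prod = begin
    Δ ((n , P) *[ α ] (m , Q))                                        ≡⟨ map-Δterms PQ _ ⟩
    applyUpTo ΔPQ-term (suc n + m)                                    ≡⟨ applyUpTo-+ ΔPQ-term (suc n) m ⟩
    applyUpTo ΔPQ-term (suc n) ++ applyUpTo (ΔPQ-term ∘ (suc n +_)) m ≡⟨ cong₂ _++_ left right ⟩
    cutP-terms ++ cutQ-terms                                          ∎
    where
    left : applyUpTo ΔPQ-term (suc n) ≡ cutP-terms
    left = applyUpTo-cong (suc n) (ΔPQ-term-cutP ∘ s≤s⁻¹)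
    right : applyUpTo (ΔPQ-term ∘ (suc n +_)) m ≡ cutQ-terms
    right = applyUpTo-cong m λ {j} j<m → trans (cong ΔPQ-term (sym (+-suc n j))) (ΔPQ-term-cutQ j<m)

  infinitesimalRHS-cut : infinitesimalRHS α (n , P) (m , Q) ≡
    cutP-terms ++ ⊗ 1ℤ (n , P) (m , Q) ∷ cutQ-terms ++ ⊗ -1ℤ (n , P) (m , Q) ∷ []
  infinitesimalRHS-cut = cong₂ _++_ (map-Δterms P _)
    (cong (_++ ⊗ -1ℤ (n , P) (m , Q) ∷ []) (trans (map-Δterms Q _) (cong (_∷ cutQ-terms) cutQ-term-zero)))

  Δ-prod-infinitesimal : Δ ((n , P) *[ α ] (m , Q)) ≈F infinitesimalRHS α (n , P) (m , Q)
  Δ-prod-infinitesimal t = begin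
    coeff (Δ ((n , P) *[ α ] (m , Q))) t             ≡⟨ cong (λ xs → coeff xs t) Δ-prod ⟩
    coeff (cutP-terms ++ cutQ-terms) t               ≡⟨ coeff-cancel cutP-terms _ cutQ-terms t ⟨
    coeff (cutP-terms ++ _ ∷ cutQ-terms ++ _ ∷ []) t ≡⟨ cong (λ xs → coeff xs t) infinitesimalRHS-cut ⟨
    coeff (infinitesimalRHS α (n , P) (m , Q)) t     ∎

arrow : Bool → Bool → Arrow
arrow true  true  = ↕
arrow true  false = ↑
arrow false true  = ↓
arrow false false = ⊔

isUp-arrow : ∀ up down → isUp (arrow up down) ≡ up
isUp-arrow true  true  = refl
isUp-arrow true  false = refl
isUp-arrow false true  = refl
isUp-arrow false false = refl

isDown-arrow : ∀ up down → isDown (arrow up down) ≡ down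
isDown-arrow true  true  = refl
isDown-arrow true  false = refl
isDown-arrow false true  = refl
isDown-arrow false false = refl

_≟⊔ : (x : Arrow) → Dec (x ≡ ⊔)
⊔ ≟⊔ = yes refl
↑ ≟⊔ = no λ ()
↓ ≟⊔ = no λ ()
↕ ≟⊔ = no λ ()

-- Trailing ⊔'s are dropped, as an element of S_R may not end with ⊔.
fromArrows : (ℕ → Arrow) → ℕ → SR
fromArrows f zero = sqcup
fromArrows f (suc k) with f k ≟⊔
... | yes _      = fromArrows f k
... | no f[k]≢⊔  = arr k (f ∘ toℕ) (f[k]≢⊔ ∘ subst (λ x → f x ≡ ⊔) (toℕ-fromℕ k))

arrowAt-fromArrows-≥ : ∀ f {k j} → k ≤ j → arrowAt (fromArrows f k) (suc j) ≡ ⊔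
arrowAt-fromArrows-≥ f {zero}      _     = refl
arrowAt-fromArrows-≥ f {suc k} {j} k+1≤j with f k ≟⊔
... | yes _ = arrowAt-fromArrows-≥ f (≤-trans (n≤1+n k) k+1≤j)
... | no _ with j <? suc k
...   | yes j<k+1 = contradiction k+1≤j (<⇒≱ j<k+1)
...   | no _      = refl

arrowAt-fromArrows : ∀ f {k j} → j < k → arrowAt (fromArrows f k) (suc j) ≡ f j
arrowAt-fromArrows f {suc k} {j} j<k+1 with f k ≟⊔ | m<1+n⇒m<n∨m≡n j<k+1
... | yes _      | inj₁ j<k  = arrowAt-fromArrows f j<k
... | yes f[k]≡⊔ | inj₂ refl = trans (arrowAt-fromArrows-≥ f {k} ≤-refl) (sym f[k]≡⊔)
... | no _       | _ with j <? suc k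
...   | yes j<k+1 = cong f (toℕ-fromℕ< j<k+1)
...   | no j≮k+1  = contradiction j<k+1 j≮k+1

headArrows : ∀ {k} → Rel (suc k) → SR
headArrows {k} R = fromArrows (λ j → arrow (at R 0 (suc j)) (at R (suc j) 0)) k

♯-prod-headArrows : ∀ {k l} (R : Rel (suc k)) → Reflexive R → (T : Rel l) →
  (l , T) ≃ (k , restrictSuf 1 R) → (1 , ♯) *[ headArrows R ] (l , T) ≃ (suc k , R)
♯-prod-headArrows {k} R R-refl T (refl , T≈R′) = refl , agree
  where
  α : SR
  α = headArrows R

  agree : ∀ {a b} → a < suc k → b < suc k → at (prod α ♯ T) a b ≡ at R a b
  agree {zero}  {zero}  _           _           =
    trans (at-prod-ll α ♯ T z<s z<s) (sym (at-refl R R-refl z<s))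
  agree {zero}  {suc b} _           (s<s b<k)   =
    trans (at-prod-lr α ♯ T z<s b<k) (trans (cong isUp (arrowAt-fromArrows _ b<k)) (isUp-arrow _ _))
  agree {suc a} {zero}  (s<s a<k)   _           =
    trans (at-prod-rl α ♯ T a<k z<s) (trans (cong isDown (arrowAt-fromArrows _ a<k)) (isDown-arrow _ _))
  agree {suc a} {suc b} (s<s a<k)   (s<s b<k)   =
    trans (at-prod-rr α ♯ T a<k b<k) (trans (T≈R′ a<k b<k) (at-restrictSuf 1 R a<k b<k))

generate : ∀ k (R : Rel (suc k)) → Reflexive R → Σ Term (λ t → eval t ≃ (suc k , R))
generate zero    R R-refl = gen , refl , agree
  where
  agree : ∀ {a b} → a < 1 → b < 1 → at ♯ a b ≡ at R a b
  agree {zero}  {zero}  _         _         = sym (at-refl R R-refl z<s)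
  agree {suc _} {_}     (s<s ())  _
  agree {_}     {suc _} _         (s<s ())
generate (suc k) R R-refl with generate k (restrictSuf 1 R) (restrictSuf-reflexive 1 R-refl)
... | t , t≃R′ = node gen (headArrows R) t , ♯-prod-headArrows R R-refl _ t≃R′

proposition4p13 :
    -- (1) every reflexive relation R ∈ R_n, n ≥ 1, is an iterated product of #
    ((n : ℕ) → 1 ≤ n → (R : Rel n) → Reflexive R →
      Σ Term (λ t → toB (eval t) ≡ toB (n , R)))
    ×
    -- (2a) the empty relation is a two-sided unit for every *_α
    ((α : SR) (n : ℕ) (P : Rel n) →
      (toB ((0 , ∅) *[ α ] (n , P)) ≡ toB (n , P))
      × (toB ((n , P) *[ α ] (0 , ∅)) ≡ toB (n , P)))
    ×
    -- (2b) unital infinitesimal relation with Δ_R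
    ((α : SR) (n m : ℕ) (P : Rel n) (Q : Rel m) → Reflexive P → Reflexive Q →
      1 ≤ n → 1 ≤ m →
      Δ ((n , P) *[ α ] (m , Q)) ≈F infinitesimalRHS α (n , P) (m , Q))
proposition4p13 =
    (λ { zero () ; (suc k) _ R R-refl → map₂ toB-≃ (generate k R R-refl) })
  , (λ α n P → toB-≃ (prod-∅ˡ α ∅ P) , toB-≃ (prod-∅ʳ α P ∅))
  , (λ α n m P Q _ _ _ _ → Infinitesimal.Δ-prod-infinitesimal α P Q)
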